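{- Let $m$ be a positive integer, $x$ a positive integer and $r\in\{0,\dots,m-1\}$. Define $y_0=(m+1)x+r$ and $y_n=\left\lfloor \frac{(m+1)y_{n-1}}{m}\right\rfloor$ for $n\ge1$. Then for every integer $n\ge0$, $\left\lfloor \frac{y_n}{m+1}\right\rfloor=x_n(x,r)$ and $y_n\equiv r_n(x,r)\pmod{m+1}$; i.e. $x_n(x,r)$ and $r_n(x,r)$ are the quotient and remainder of $y_n$ upon division by $m+1$.
   Context: The triangle $T_m$ (rotation number $m$) is the array whose row $x$ ($x=1,2,\dots$) has $x$ entries in columns $0,\dots,x-1$, defined by: $T_m(1,0)=1$; for $x>1$ and $0\le c\le x-2$, $T_m(x,c)=T_m(x-1,c+m)$; and $T_m(x,x-1)=1+T_m(x-1,0)$, where for any integer $c$, $T_m(x,c)$ denotes the entry in row $x$ and column ($c$ mod $x$). Entries are regarded as individuals that move: the individual in column $c$ of row $y$ is the individual in column $(c-m)\bmod y$ of row $y+1$. An individual is said to be at position $(y,c)$ for any integer $c$ congruent modulo $y$ to its actual column in row $y$. For a positive integer $x$ and $r\in\{0,\dots,m-1\}$, consider the individual at position $(x,r)$. Set $x_0(x,r)=x$, $r_0(x,r)=r$, and for $n\ge1$ let $(x_n(x,r),r_n(x,r))$ be the lexicographically smallest pair of integers with $x_n\ge x_{n-1}$, $0\le r_n\le m-1$, $r_n>r_{n-1}$ if $x_n=x_{n-1}$, and such that this individual is at position $(x_n,r_n)$. -}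

module Defs where

open import Data.Nat using (ℕ; zero; suc; _+_; _*_; _∸_; _≤_; _<_; NonZero)
open import Data.Nat.DivMod using (_/_; _%_)
open import Data.Product using (Σ; _×_)
open import Data.Sum using (_⊎_)
open import Relation.Binary.PropositionalEquality using (_≡_)

Cong : ℕ → ℕ → ℕ → Set
Cong a b y = Σ ℕ λ i → Σ ℕ λ j → a + i * y ≡ b + j * y

-- col m x r k : the actual column, in row x + k, of the individual that is
-- at position (x , r) (i.e. in column r mod x of row x).
-- Movement rule: column c of row y  ↦  column (c - m) mod y of row y + 1,
-- computed in ℕ as (c + (y - 1) * m) mod y  (y ≥ 1).
-- The case x = 0 is junk (rows are numbered from 1).
col : ℕ → ℕ → ℕ → ℕ → ℕ
col m zero     r k       = 0
col m (suc x') r zero    = r % suc x'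
col m (suc x') r (suc k) = (col m (suc x') r k + (x' + k) * m) % suc (x' + k)

AtPos : ℕ → ℕ → ℕ → ℕ → ℕ → Set
AtPos m x r y c = Σ ℕ λ k → (y ≡ x + k) × Cong c (col m x r k) y

Cand : ℕ → ℕ → ℕ → ℕ → ℕ → ℕ → ℕ → Set
Cand m x r a b a' b' =
  (a ≤ a') × (b' < m) × ((a' ≡ a → b < b') × AtPos m x r a' b')

LexLeq : ℕ → ℕ → ℕ → ℕ → Set
LexLeq a b a' b' = (a < a') ⊎ ((a ≡ a') × (b ≤ b'))

Next : ℕ → ℕ → ℕ → ℕ → ℕ → ℕ → ℕ → Set
Next m x r a b a' b' =
  Cand m x r a b a' b' × ((a'' b'' : ℕ) → Cand m x r a b a'' b'' → LexLeq a' b' a'' b'')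

-- XR m x r n a b  means  (x_n(x,r) , r_n(x,r)) = (a , b).
data XR (m x r : ℕ) : ℕ → ℕ → ℕ → Set where
  xr-zero : XR m x r zero x r
  xr-suc  : ∀ {n a b a' b'} → XR m x r n a b → Next m x r a b a' b' → XR m x r (suc n) a' b'

yseq : (m x r : ℕ) → .{{_ : NonZero m}} → ℕ → ℕ
yseq m x r zero    = suc m * x + r
yseq m x r (suc n) = (suc m * yseq m x r n) / m

{-# OPTIONS --safe #-}

-- An individual at position (a , b) of row a, with b < m, is also at position s = a + b.
-- Going down j rows moves it j·m columns to the left, and since s − m < a this never wraps
-- around while s − j·m ≥ 0: for j ≥ 1 it is in column s − j·m of row a + j.  So the first column
-- below m it reaches (after column b of row a) is s mod m, in row a + ⌊s/m⌋, and the step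
-- (a , b) ↦ (a + ⌊(a+b)/m⌋ , (a+b) mod m) is exactly y ↦ ⌊(m+1)y/m⌋ written in base m + 1:
-- if y = (m+1)a + b then (m+1)y = m((m+2)a + b) + s.

module Submission where

open import Defs
open import Data.Nat using (ℕ; zero; suc; _+_; _*_; _∸_; _≤_; _<_; s≤s; z≤n; NonZero)
open import Data.Nat.DivMod
open import Data.Nat.Divisibility using (∣-refl; divides-refl; m∣m*n)
open import Data.Nat.Properties
open import Data.Nat.Tactic.RingSolver using (solve)
open import Data.List using ([]; _∷_)
open import Algebra.Properties.CommutativeSemigroup +-commutativeSemigroup using (xy∙z≈xz∙y; x∙yz≈y∙xz)
open import Data.Product using (_×_; _,_; proj₁; proj₂)
open import Data.Sum using (inj₁; inj₂)
open import Data.Empty using (⊥-elim)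
open import Relation.Binary using (tri<; tri≈; tri>)
open import Relation.Binary.PropositionalEquality

/-%-unique : ∀ d .{{_ : NonZero d}} {y a b} → b < d → y ≡ b + a * d → y / d ≡ a × y % d ≡ b
/-%-unique d {a = a} {b} b<d refl = quotient , trans ([m+kn]%n≡m%n b a d) (m<n⇒m%n≡m b<d)
  where
  open ≡-Reasoning
  quotient : (b + a * d) / d ≡ a
  quotient = begin
    (b + a * d) / d    ≡⟨ +-distrib-/-∣ʳ b (divides-refl a) ⟩
    b / d + a * d / d  ≡⟨ cong₂ _+_ (m<n⇒m/n≡0 b<d) (m*n/n≡m a d) ⟩
    a                  ∎

Cong⇒%≡ : ∀ {a b y} .{{_ : NonZero y}} → Cong a b y → a % y ≡ b % y
Cong⇒%≡ {a} {b} {y} (i , j , e) = begin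
  a % y           ≡⟨ [m+kn]%n≡m%n a i y ⟨
  (a + i * y) % y ≡⟨ cong (_% y) e ⟩
  (b + j * y) % y ≡⟨ [m+kn]%n≡m%n b j y ⟩
  b % y           ∎
  where open ≡-Reasoning

%≡⇒Cong : ∀ {a b y} .{{_ : NonZero y}} → a % y ≡ b % y → Cong a b y
%≡⇒Cong {a} {b} {y} e = b / y , a / y , (begin
  a + b / y * y                 ≡⟨ cong (_+ b / y * y) (m≡m%n+[m/n]*n a y) ⟩
  a % y + a / y * y + b / y * y ≡⟨ cong (λ z → z + a / y * y + b / y * y) e ⟩
  b % y + a / y * y + b / y * y ≡⟨ xy∙z≈xz∙y (b % y) (a / y * y) (b / y * y) ⟩
  b % y + b / y * y + a / y * y ≡⟨ cong (_+ a / y * y) (m≡m%n+[m/n]*n b y) ⟨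
  b + a / y * y                 ∎)
  where open ≡-Reasoning

%≡∧<⇒+≤ : ∀ d .{{_ : NonZero d}} {b c} → b < c → c % d ≡ b % d → d + b ≤ c
%≡∧<⇒+≤ d {b} {c} b<c e = begin
  d + b                   ≡⟨ cong (d +_) (m≡m%n+[m/n]*n b d) ⟩
  d + (b % d + b / d * d) ≡⟨ x∙yz≈y∙xz d (b % d) (b / d * d) ⟩
  b % d + suc (b / d) * d ≤⟨ +-monoʳ-≤ (b % d) (*-monoˡ-≤ d quotient<) ⟩
  b % d + c / d * d       ≡⟨ cong (_+ c / d * d) e ⟨
  c % d + c / d * d       ≡⟨ m≡m%n+[m/n]*n c d ⟨
  c                       ∎
  where
  open ≤-Reasoning
  quotient< : b / d < c / d
  quotient< = *-cancelʳ-< d (b / d) (c / d) (+-cancelˡ-< (b % d) _ _ (begin-strict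
    b % d + b / d * d ≡⟨ m≡m%n+[m/n]*n b d ⟨
    b                 <⟨ b<c ⟩
    c                 ≡⟨ m≡m%n+[m/n]*n c d ⟩
    c % d + c / d * d ≡⟨ cong (_+ c / d * d) e ⟩
    b % d + c / d * d ∎))

%-shift : ∀ {m} R c t → c % suc R ≡ t % suc R → m ≤ t → t ∸ m < suc R →
          (c + R * m) % suc R ≡ t ∸ m
%-shift {m} R c t e m≤t t∸m<1+R = begin
  (c + R * m) % suc R                          ≡⟨ %-distribˡ-+ c (R * m) (suc R) ⟩
  (c % suc R + (R * m) % suc R) % suc R        ≡⟨ cong (λ z → (z + (R * m) % suc R) % suc R) e ⟩
  (t % suc R + (R * m) % suc R) % suc R        ≡⟨ %-distribˡ-+ t (R * m) (suc R) ⟨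
  (t + R * m) % suc R                          ≡⟨ cong (λ z → (z + R * m) % suc R) (m∸n+n≡m m≤t) ⟨
  (t ∸ m + m + R * m) % suc R                  ≡⟨ cong (_% suc R) (+-assoc (t ∸ m) m (R * m)) ⟩
  (t ∸ m + suc R * m) % suc R                  ≡⟨ %-remove-+ʳ (t ∸ m) (m∣m*n m) ⟩
  (t ∸ m) % suc R                              ≡⟨ m<n⇒m%n≡m t∸m<1+R ⟩
  t ∸ m                                        ∎
  where open ≡-Reasoning

module Trajectory (m : ℕ) .{{_ : NonZero m}} (x-1 r : ℕ) where

  row : ℕ → ℕ
  row k = suc x-1 + k

  column : ℕ → ℕ
  column = col m (suc x-1) r

  column<row : ∀ k → column k < row k
  column<row zero    = <-≤-trans (m%n<n r (suc x-1)) (m≤m+n (suc x-1) 0)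
  column<row (suc k) =
    <-≤-trans (m%n<n (column k + (x-1 + k) * m) (row k)) (+-monoʳ-≤ (suc x-1) (n≤1+n k))

  row-+ : ∀ k j → row k + j ≡ row (j + k)
  row-+ k j = cong suc (trans (+-assoc x-1 k j) (cong (x-1 +_) (+-comm k j)))

  module _ (k b : ℕ) (b<m : b < m) (at : column k % row k ≡ b % row k) where

    s : ℕ
    s = row k + b

    s%row≡b%row : s % row k ≡ b % row k
    s%row≡b%row = %-remove-+ˡ b ∣-refl

    s∸m<row : s ∸ m < row k
    s∸m<row = m<n+o⇒m∸n<o s m (subst (s <_) (+-comm (row k) m) (+-monoʳ-< (row k) b<m))

    descend-once : ∀ j → suc j * m ≤ s →
                   column (j + k) % row (j + k) ≡ (s ∸ j * m) % row (j + k) →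
                   column (suc j + k) ≡ s ∸ suc j * m
    descend-once j le e = begin
      column (suc j + k) ≡⟨ %-shift (x-1 + (j + k)) (column (j + k)) (s ∸ j * m) e m≤ below ⟩
      s ∸ j * m ∸ m      ≡⟨ ∸-+-assoc s (j * m) m ⟩
      s ∸ (j * m + m)    ≡⟨ cong (s ∸_) (+-comm (j * m) m) ⟩
      s ∸ suc j * m      ∎
      where
      open ≡-Reasoning
      m≤ : m ≤ s ∸ j * m
      m≤ = m+n≤o⇒m≤o∸n m le
      below : s ∸ j * m ∸ m < row (j + k)
      below = ≤-<-trans (∸-monoˡ-≤ m (m∸n≤m s (j * m)))
                (<-≤-trans s∸m<row (+-monoʳ-≤ (suc x-1) (m≤n+m k j)))

    column-after : ∀ j → suc j * m ≤ s → column (suc j + k) ≡ s ∸ suc j * m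
    column-after zero    le = descend-once zero le (trans at (sym s%row≡b%row))
    column-after (suc j) le = descend-once (suc j) le
      (cong (_% row (suc j + k)) (column-after j (≤-trans (m≤n+m (suc j * m) m) le)))

    column-mod-row : ∀ j → j * m ≤ s → column (j + k) % row (j + k) ≡ (s ∸ j * m) % row (j + k)
    column-mod-row zero    _  = trans at (sym s%row≡b%row)
    column-mod-row (suc j) le = cong (_% row (suc j + k)) (column-after j le)

    lower-bound : ∀ j {c} → j * m ≤ s → (j ≡ 0 → b < c) →
                  column (j + k) % row (j + k) ≡ c % row (j + k) → s ∸ j * m ≤ c
    lower-bound zero    _  b<c e = %≡∧<⇒+≤ (row k) (b<c refl) (trans (sym e) at)
    lower-bound (suc j) {c} le _ e = begin
      s ∸ suc j * m                        ≡⟨ column-after j le ⟨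
      column (suc j + k)                   ≡⟨ m<n⇒m%n≡m (column<row (suc j + k)) ⟨
      column (suc j + k) % row (suc j + k) ≡⟨ e ⟩
      c % row (suc j + k)                  ≤⟨ m%n≤m c (row (suc j + k)) ⟩
      c                                    ∎
      where open ≤-Reasoning

    q : ℕ
    q = s / m

    q*m≤s : q * m ≤ s
    q*m≤s = m/n*n≤m s m

    s∸q*m≡s%m : s ∸ q * m ≡ s % m
    s∸q*m≡s%m = sym (m%n≡m∸m/n*n s m)

    candidate : Cand m (suc x-1) r (row k) b (row k + q) (s % m)
    candidate = m≤m+n (row k) q , m%n<n s m , same-row
              , (q + k , row-+ k q , subst (Cong (s % m) (column (q + k))) (sym (row-+ k q)) congruent)
      where
      congruent : Cong (s % m) (column (q + k)) (row (q + k))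
      congruent = %≡⇒Cong (sym (trans (column-mod-row q q*m≤s) (cong (_% row (q + k)) s∸q*m≡s%m)))
      same-row : row k + q ≡ row k → b < s % m
      same-row eq = subst (b <_) (trans (cong (λ i → s ∸ i * m) (sym q≡0)) s∸q*m≡s%m)
                          (m<n+m b (s≤s z≤n))
        where
        q≡0 : q ≡ 0
        q≡0 = +-cancelˡ-≡ (row k) q 0 (trans eq (sym (+-identityʳ (row k))))

    minimal-at : ∀ j {c} → c < m → (j ≡ 0 → b < c) →
                 column (j + k) % row (j + k) ≡ c % row (j + k) →
                 LexLeq (row k + q) (s % m) (row (j + k)) c
    minimal-at j c<m same e with <-cmp j q
    ... | tri< j<q _ _ = ⊥-elim (<⇒≱ c<m (≤-trans m≤s∸j*m (lower-bound j j*m≤s same e)))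
      where
      j*m≤s : j * m ≤ s
      j*m≤s = ≤-trans (*-monoˡ-≤ m (<⇒≤ j<q)) q*m≤s
      m≤s∸j*m : m ≤ s ∸ j * m
      m≤s∸j*m = m+n≤o⇒m≤o∸n m (≤-trans (*-monoˡ-≤ m j<q) q*m≤s)
    ... | tri≈ _ refl _ = inj₂ (row-+ k q , subst (_≤ _) s∸q*m≡s%m (lower-bound q q*m≤s same e))
    ... | tri> _ _ q<j = inj₁ (subst (_< row (j + k)) (sym (row-+ k q))
                                     (+-monoʳ-< (suc x-1) (+-monoˡ-< k q<j)))

    minimal : ∀ a c → Cand m (suc x-1) r (row k) b a c → LexLeq (row k + q) (s % m) a c
    minimal .(row k′) c (row≤ , c<m , same , k′ , refl , cg) =
      subst (λ i → LexLeq (row k + q) (s % m) (row i) c) shift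
        (minimal-at (k′ ∸ k) c<m (λ j≡0 → same (cong row (trans (sym shift) (cong (_+ k) j≡0))))
          (sym (Cong⇒%≡ (subst (λ i → Cong c (column i) (row i)) (sym shift) cg))))
      where
      shift : k′ ∸ k + k ≡ k′
      shift = m∸n+n≡m (+-cancelˡ-≤ (suc x-1) k k′ row≤)

  next-pair : ∀ {a b} → b < m × AtPos m (suc x-1) r a b →
              Next m (suc x-1) r a b (a + (a + b) / m) ((a + b) % m)
  next-pair {b = b} (b<m , k , refl , cg) = candidate k b b<m at , minimal k b b<m at
    where
    at : column k % row k ≡ b % row k
    at = sym (Cong⇒%≡ cg)

yseq-step : ∀ m .{{_ : NonZero m}} {y} a b → y ≡ b + a * suc m →
            (suc m * y) / m ≡ (a + b) % m + (a + (a + b) / m) * suc m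
yseq-step m {y} a b y≡ = begin
  (suc m * y) / m                             ≡⟨ /-congˡ (product r q s≡) ⟩
  (r + (q + (b + a * suc m + a)) * m) / m     ≡⟨ proj₁ (/-%-unique m (m%n<n (a + b) m) refl) ⟩
  q + (b + a * suc m + a)                     ≡⟨ quotient r q s≡ ⟩
  r + (a + q) * suc m                         ∎
  where
  open ≡-Reasoning
  r q : ℕ
  r = (a + b) % m
  q = (a + b) / m
  s≡ : a + b ≡ r + q * m
  s≡ = m≡m%n+[m/n]*n (a + b) m
  product : ∀ r q → a + b ≡ r + q * m → suc m * y ≡ r + (q + (b + a * suc m + a)) * m
  product r q a+b≡ = begin
    suc m * y                               ≡⟨ cong (suc m *_) y≡ ⟩
    suc m * (b + a * suc m)                 ≡⟨ solve (a ∷ b ∷ m ∷ []) ⟩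
    (a + b) + (b + a * suc m + a) * m       ≡⟨ cong (_+ (b + a * suc m + a) * m) a+b≡ ⟩
    (r + q * m) + (b + a * suc m + a) * m   ≡⟨ solve (r ∷ q ∷ m ∷ b ∷ a ∷ []) ⟩
    r + (q + (b + a * suc m + a)) * m       ∎
  quotient : ∀ r q → a + b ≡ r + q * m → q + (b + a * suc m + a) ≡ r + (a + q) * suc m
  quotient r q a+b≡ = begin
    q + (b + a * suc m + a)                 ≡⟨ solve (q ∷ a ∷ b ∷ m ∷ []) ⟩
    (a + b) + q + a * suc m                 ≡⟨ cong (λ z → z + q + a * suc m) a+b≡ ⟩
    r + q * m + q + a * suc m               ≡⟨ solve (r ∷ q ∷ m ∷ a ∷ []) ⟩
    r + (a + q) * suc m                     ∎

XR-decode : ∀ {m x r n a b y} → b < suc m → y ≡ b + a * suc m →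
            XR m x r n a b → XR m x r n (y / suc m) (y % suc m)
XR-decode {m} {x} {r} {n} {a} {b} {y} b<1+m y≡ = subst₂ (XR m x r n) (sym (proj₁ y/%)) (sym (proj₂ y/%))
  where
  y/% : y / suc m ≡ a × y % suc m ≡ b
  y/% = /-%-unique (suc m) b<1+m y≡

XR⇒AtPos : ∀ {m x-1 r n a b} → r < m → XR m (suc x-1) r n a b → b < m × AtPos m (suc x-1) r a b
XR⇒AtPos {x-1 = x-1} {r} r<m xr-zero =
  r<m , 0 , sym (+-identityʳ (suc x-1)) , %≡⇒Cong (sym (m%n%n≡m%n r (suc x-1)))
XR⇒AtPos _ (xr-suc _ ((_ , b<m , _ , at) , _)) = b<m , at

xr-yseq : ∀ m .{{_ : NonZero m}} x-1 r → r < m → ∀ n →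
          XR m (suc x-1) r n (yseq m (suc x-1) r n / suc m) (yseq m (suc x-1) r n % suc m)
xr-yseq m x-1 r r<m zero = XR-decode (m<n⇒m<1+n r<m) y₀≡ xr-zero
  where
  y₀≡ : suc m * suc x-1 + r ≡ r + suc x-1 * suc m
  y₀≡ = trans (+-comm (suc m * suc x-1) r) (cong (r +_) (*-comm (suc m) (suc x-1)))
xr-yseq m x-1 r r<m (suc n) =
  XR-decode (m<n⇒m<1+n (m%n<n (a + b) m)) (yseq-step m a b (m≡m%n+[m/n]*n y (suc m)))
    (xr-suc xrₙ (Trajectory.next-pair m x-1 r (XR⇒AtPos r<m xrₙ)))
  where
  y a b : ℕ
  y = yseq m (suc x-1) r n
  a = y / suc m
  b = y % suc m
  xrₙ : XR m (suc x-1) r n a b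
  xrₙ = xr-yseq m x-1 r r<m n

proposition1 : (m x r : ℕ) → .{{_ : NonZero m}} → .{{_ : NonZero x}} → r < m → (n : ℕ) →
    XR m x r n (yseq m x r n / suc m) (yseq m x r n % suc m)
proposition1 m zero      r {{_}} {{()}} r<m n
proposition1 m (suc x-1) r r<m n = xr-yseq m x-1 r r<m n
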